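{- There exist a set of labels $\mathbb{U}$, a cycle property $Y \subseteq \mathbb{U}^*$ that is closed under cyclic permutations, and an arena $\mathcal{A}$ with labels in $\mathbb{U}$ such that the first cycle game $(\mathcal{A}, O_{\mathrm{FC}(Y)}(\mathcal{A}))$ is not pointwise memoryless determined.
   Context: An arena is a tuple $\mathcal{A}=(V_0,V_1,E,\mathbb{U},\lambda)$ where $V_0,V_1$ are disjoint finite sets (the vertices of Player 0 and Player 1) with $V:=V_0\cup V_1$ non-empty, $E\subseteq V\times V$ is a set of edges such that every vertex has at least one outgoing edge, $\mathbb{U}$ is a set of labels, and $\lambda:E\to\mathbb{U}$. For a sequence of edges $u=e_1e_2\cdots$, write $\lambda(u)=\lambda(e_1)\lambda(e_2)\cdots$. A play is an infinite sequence $\pi=\pi_0\pi_1\cdots$ of vertices with $(\pi_j,\pi_{j+1})\in E$ for all $j$; $\mathrm{plays}(\mathcal{A})$ is the set of plays. A strategy for Player $i$ is a function $S:V^*V_i\to V$ with $(v,S(uv))\in E$ for all $u\in V^*$, $v\in V_i$; it is memoryless if $S(uv)=S(u'v)$ for all $u,u'\in V^*$, $v\in V_i$. A play is consistent with a strategy $S$ of Player $i$ if $\pi_{j+1}=S(\pi_0\cdots\pi_j)$ whenever $\pi_j\in V_i$. A game is a pair $(\mathcal{A},O)$ with $O\subseteq\mathrm{plays}(\mathcal{A})$; a play is won by Player 0 if it is in $O$ and by Player 1 otherwise. A strategy for Player $i$ is winning from $v$ if every play starting at $v$ consistent with it is won by Player $i$. The winning region of Player $i$ is the set of vertices from which Player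 $i$ has a winning strategy. The game is determined if the two winning regions partition $V$; it is pointwise memoryless for Player $i$ if from every vertex of Player $i$'s winning region Player $i$ has a memoryless winning strategy; it is pointwise memoryless determined if it is determined and pointwise memoryless for both players. A cycle is a sequence of edges $(v_1,v_2)(v_2,v_3)\cdots(v_{k-1},v_k)(v_k,v_1)$. The cycles-decomposition $\mathrm{cycles}(\pi)$ of a play $\pi$ is the sequence of cycles output by the following procedure: start with an empty stack; at step $j=0,1,2,\dots$ push the edge $(\pi_j,\pi_{j+1})$, and if for some $k$ the top $k$ edges of the stack form a cycle, pop this cycle and output it. The first cycle of $\pi$ is the first cycle in $\mathrm{cycles}(\pi)$. A cycle property is a set $Y\subseteq\mathbb{U}^*$. $Y$ is closed under cyclic permutations if $ab\in Y$ implies $ba\in Y$ for all $a\in\mathbb{U}$, $b\in\mathbb{U}^*$. $O_{\mathrm{FC}(Y)}(\mathcal{A})$ is the set of plays $\pi$ such that $\lambda(u)\in Y$, where $u$ is the first cycle of $\pi$. -}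

module Defs where

open import Data.Nat using (ℕ; zero; suc; _<_)
open import Data.Fin using (Fin; _≟_)
open import Data.Bool using (Bool; true; false; _∧_; if_then_else_)
open import Data.Product using (Σ; ∃; _×_; _,_; proj₁; proj₂)
open import Data.Sum using (_⊎_)
open import Data.List using (List; []; _∷_; map; upTo; _∷ʳ_)
open import Data.Maybe using (Maybe; just; nothing)
open import Relation.Nullary using (¬_)
open import Relation.Nullary.Decidable using (⌊_⌋)
open import Relation.Binary.PropositionalEquality using (_≡_)

Player : Set
Player = Fin 2

-- Labels: λ is given on all pairs of vertices; only its values on edges matter.
record Arena (U : Set) : Set₁ where
  field
    m      : ℕ
    owner  : Fin (suc m) → Player
    E      : Fin (suc m) → Fin (suc m) → Set
    total  : ∀ v → ∃ λ w → E v w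
    lab    : Fin (suc m) → Fin (suc m) → U

module _ {U : Set} (A : Arena U) where
  open Arena A

  V : Set
  V = Fin (suc m)

  Edge : Set
  Edge = V × V

  Play : Set
  Play = Σ (ℕ → V) λ π → ∀ j → E (π j) (π (suc j))

  -- strategies for player i: S : V* V_i → V (values on other vertices irrelevant)
  Strategy : Player → Set
  Strategy i = Σ (List V → V → V) λ S → ∀ u v → owner v ≡ i → E v (S u v)

  Memoryless : ∀ {i} → Strategy i → Set
  Memoryless (S , _) = ∀ u u' v → S u v ≡ S u' v

  -- π₀ ⋯ π_{j-1}
  prefix : (ℕ → V) → ℕ → List V
  prefix π j = map π (upTo j)

  Consistent : ∀ {i} → Strategy i → Play → Set
  Consistent {i} (S , _) (π , _) =
    ∀ j → owner (π j) ≡ i → π (suc j) ≡ S (prefix π j) (π j)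

  _==_ : V → V → Bool
  a == b = ⌊ a ≟ b ⌋

  lastEdge : Edge → List Edge → Edge
  lastEdge e [] = e
  lastEdge _ (f ∷ r) = lastEdge f r

  chainB : Edge → List Edge → Bool
  chainB e [] = true
  chainB e (f ∷ r) = (proj₂ e == proj₁ f) ∧ chainB f r

  isCycleB : List Edge → Bool
  isCycleB [] = false
  isCycleB (e ∷ r) = chainB e r ∧ (proj₂ (lastEdge e r) == proj₁ e)

  -- stack is stored top-first. Searching k = 1, 2, … : the candidate `cand`
  -- holds the top k edges in push order.
  findTop : List Edge → List Edge → Maybe (List Edge × List Edge)
  findTop cand [] = nothing
  findTop cand (e ∷ rest) =
    if isCycleB (e ∷ cand) then just ((e ∷ cand) , rest) else findTop (e ∷ cand) rest

  stackStep : List Edge → Edge → List Edge × Maybe (List Edge)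
  stackStep s e with findTop [] (e ∷ s)
  ... | just (c , rest) = rest , just c
  ... | nothing = (e ∷ s) , nothing

  run : (ℕ → V) → ℕ → List Edge × Maybe (List Edge)
  run π zero = stackStep [] (π 0 , π 1)
  run π (suc j) = stackStep (proj₁ (run π j)) (π (suc j) , π (suc (suc j)))

  output : (ℕ → V) → ℕ → Maybe (List Edge)
  output π j = proj₂ (run π j)

  FirstCycle : Play → List Edge → Set
  FirstCycle (π , _) c =
    Σ ℕ λ j → (output π j ≡ just c) × (∀ j' → j' < j → output π j' ≡ nothing)

  labels : List Edge → List U
  labels = map (λ e → lab (proj₁ e) (proj₂ e))

  O-FC : (List U → Set) → Play → Set
  O-FC Y π = Σ (List Edge) λ c → FirstCycle π c × Y (labels c)

  module Game (O : Play → Set) where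
    WonBy : Player → Play → Set
    WonBy Fin.zero π = O π
    WonBy (Fin.suc _) π = ¬ O π

    WinningFrom : ∀ {i} → Strategy i → V → Set
    WinningFrom {i} S v = ∀ (p : Play) → proj₁ p 0 ≡ v → Consistent S p → WonBy i p

    WinReg : Player → V → Set
    WinReg i v = Σ (Strategy i) λ S → WinningFrom S v

    Determined : Set
    Determined = ∀ v → (WinReg Fin.zero v ⊎ WinReg (Fin.suc Fin.zero) v)
                     × ¬ (WinReg Fin.zero v × WinReg (Fin.suc Fin.zero) v)

    PointwiseMemoryless : Player → Set
    PointwiseMemoryless i =
      ∀ v → WinReg i v → Σ (Strategy i) λ S → Memoryless S × WinningFrom S v

    PointwiseMemorylessDetermined : Set
    PointwiseMemorylessDetermined =
      Determined × PointwiseMemoryless Fin.zero × PointwiseMemoryless (Fin.suc Fin.zero)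

ClosedUnderCyclicPermutations : {U : Set} → (List U → Set) → Set
ClosedUnderCyclicPermutations {U} Y = ∀ (a : U) (b : List U) → Y (a ∷ b) → Y (b ∷ʳ a)

module Submission where

-- Take one label (so a cycle property only sees lengths) and let
-- Y hold for words of length 3 or 5; any length condition is closed under
-- cyclic permutations.  In the arena below, Player 1 starts at s and picks a
-- short branch s → a → x or a long branch s → b → c → x; at x Player 0 returns
-- either directly (x → s) or through a detour (x → t → s).  The four possible
-- first cycles have lengths 3, 4, 4, 5, so Player 0 wins from s exactly when
-- she returns directly after the short branch and detours after the long one.
-- Remembering the branch wins; a memoryless strategy makes one fixed choice
-- at x and loses against one of Player 1's branches.

open import Defs
open import Function using (_∘_)
open import Data.Unit using (⊤; tt)
open import Data.Product using (Σ; _×_; _,_; proj₁; proj₂)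
open import Data.Sum using (_⊎_; inj₁; inj₂)
open import Data.Bool using (Bool; true; false; if_then_else_)
open import Data.Bool.ListAction using (any)
open import Data.Maybe using (just; nothing)
open import Data.Maybe.Properties using (just-injective)
open import Data.List using (List; []; _∷_; length)
open import Data.List.Properties using (length-++)
open import Data.Nat using (ℕ; zero; suc; _≤_; _<_; z≤n; s≤s)
open import Data.Nat.Properties using (≤-refl; n≤1+n; ≤-trans; <⇒≤; <-cmp; +-comm)
open import Data.Fin using (Fin; _≟_)
open import Relation.Binary using (tri<; tri≈; tri>)
open import Relation.Binary.PropositionalEquality
  using (_≡_; refl; sym; trans; cong; cong₂; subst)
open import Relation.Nullary using (¬_)
open import Relation.Nullary.Decidable using (⌊_⌋)

length-closed : {U : Set} (P : ℕ → Set) → ClosedUnderCyclicPermutations {U} (P ∘ length)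
length-closed P a b =
  subst P (sym (trans (length-++ b) (+-comm (length b) 1)))

module _ {U : Set} (A : Arena U) where
  open Arena A

  AgreeUpTo : (ℕ → V A) → ℕ → (ℕ → V A) → Set
  AgreeUpTo π n π' = ∀ k → k ≤ n → π k ≡ π' k

  agree-weaken : ∀ {π π' m n} → m ≤ n → AgreeUpTo π n π' → AgreeUpTo π m π'
  agree-weaken m≤n agree k k≤m = agree k (≤-trans k≤m m≤n)

  run-prefix : ∀ {π π'} j → AgreeUpTo π (suc j) π' → run A π j ≡ run A π' j
  run-prefix zero agree =
    cong₂ (λ v w → stackStep A [] (v , w)) (agree 0 z≤n) (agree 1 (s≤s z≤n))
  run-prefix (suc j) agree =
    cong₂ (λ st e → stackStep A (proj₁ st) e)
      (run-prefix j (agree-weaken (n≤1+n (suc j)) agree))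
      (cong₂ _,_ (agree (suc j) (n≤1+n (suc j))) (agree (suc (suc j)) ≤-refl))

  firstCycle-prefix : ∀ {π' c} (p : Play A) (n : ℕ) → AgreeUpTo (proj₁ p) (suc n) π' →
    output A π' n ≡ just c → (∀ j → j < n → output A π' j ≡ nothing) →
    FirstCycle A p c
  firstCycle-prefix p n agree out before =
    n , trans (cong proj₂ (run-prefix n agree)) out ,
    λ j j<n → trans (cong proj₂ (run-prefix j (agree-weaken (s≤s (<⇒≤ j<n)) agree)))
                    (before j j<n)

  firstCycle-unique : ∀ {p c c'} → FirstCycle A p c → FirstCycle A p c' → c ≡ c'
  firstCycle-unique (j , out , before) (j' , out' , before') with <-cmp j j'
  ... | tri< j<j' _ _ with () ← trans (sym out) (before' j j<j')
  ... | tri≈ _ refl _ = just-injective (trans (sym out) out')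
  ... | tri> _ _ j'<j with () ← trans (sym out') (before j' j'<j)

  firstCycle-losing : ∀ {Y p c} → FirstCycle A p c → ¬ Y (labels A c) → ¬ O-FC A Y p
  firstCycle-losing {Y} {p} fc ¬y (c' , fc' , y) =
    ¬y (subst (Y ∘ labels A) (firstCycle-unique {p} fc' fc) y)

  edgeFrom : ∀ {k v} (p : Play A) → proj₁ p k ≡ v → E v (proj₁ p (suc k))
  edgeFrom {k} (π , edge) πk≡v = subst (λ v → E v (π (suc k))) πk≡v (edge k)

  memoryless-consistent : ∀ {i} (S : Strategy A i) → Memoryless A S → (p : Play A) →
    (∀ j → owner (proj₁ p j) ≡ i → proj₁ p (suc j) ≡ proj₁ S [] (proj₁ p j)) →
    Consistent A S p
  memoryless-consistent (σ , _) mem (π , _) follows j owns =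
    trans (follows j owns) (mem [] (prefix A π j) (π j))

pattern vs = Fin.zero
pattern va = Fin.suc Fin.zero
pattern vb = Fin.suc (Fin.suc Fin.zero)
pattern vc = Fin.suc (Fin.suc (Fin.suc Fin.zero))
pattern vx = Fin.suc (Fin.suc (Fin.suc (Fin.suc Fin.zero)))
pattern vt = Fin.suc (Fin.suc (Fin.suc (Fin.suc (Fin.suc Fin.zero))))

Vertex : Set
Vertex = Fin 6

Edge⁺ : Vertex → Vertex → Set
Edge⁺ vs w = w ≡ va ⊎ w ≡ vb
Edge⁺ va w = w ≡ vx
Edge⁺ vb w = w ≡ vc
Edge⁺ vc w = w ≡ vx
Edge⁺ vx w = w ≡ vs ⊎ w ≡ vt
Edge⁺ vt w = w ≡ vs

owner⁺ : Vertex → Player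
owner⁺ vs = Fin.suc Fin.zero
owner⁺ _  = Fin.zero

successor : ∀ v → Σ Vertex λ w → Edge⁺ v w
successor vs = va , inj₁ refl
successor va = vx , refl
successor vb = vc , refl
successor vc = vx , refl
successor vx = vs , inj₁ refl
successor vt = vs , refl

arena : Arena ⊤
arena = record { m = 5 ; owner = owner⁺ ; E = Edge⁺ ; total = successor ; lab = λ _ _ → tt }

-- The winning first cycles: those of length 3 (s a x s) or 5 (s b c x t s).
GoodLength : ℕ → Set
GoodLength n = n ≡ 3 ⊎ n ≡ 5

Y : List ⊤ → Set
Y = GoodLength ∘ length

open Game arena (O-FC arena Y)

longDirect : ℕ → Vertex
longDirect 0 = vs
longDirect 1 = vb
longDirect 2 = vc
longDirect 3 = vx
longDirect (suc (suc (suc (suc n)))) = longDirect n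

longDirect-edges : ∀ j → Edge⁺ (longDirect j) (longDirect (suc j))
longDirect-edges 0 = inj₂ refl
longDirect-edges 1 = refl
longDirect-edges 2 = refl
longDirect-edges 3 = inj₁ refl
longDirect-edges (suc (suc (suc (suc n)))) = longDirect-edges n

longDirect-loses : ¬ O-FC arena Y (longDirect , longDirect-edges)
longDirect-loses = firstCycle-losing arena {Y = Y} {p = p}
  (firstCycle-prefix arena p 3 (λ _ _ → refl) refl
    λ { 0 _ → refl ; 1 _ → refl ; 2 _ → refl ; (suc (suc (suc _))) (s≤s (s≤s (s≤s ()))) })
  λ { (inj₁ ()) ; (inj₂ ()) }
  where p = longDirect , longDirect-edges

shortDetour : ℕ → Vertex
shortDetour 0 = vs
shortDetour 1 = va
shortDetour 2 = vx
shortDetour 3 = vt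
shortDetour (suc (suc (suc (suc n)))) = shortDetour n

shortDetour-edges : ∀ j → Edge⁺ (shortDetour j) (shortDetour (suc j))
shortDetour-edges 0 = inj₁ refl
shortDetour-edges 1 = refl
shortDetour-edges 2 = inj₂ refl
shortDetour-edges 3 = refl
shortDetour-edges (suc (suc (suc (suc n)))) = shortDetour-edges n

shortDetour-loses : ¬ O-FC arena Y (shortDetour , shortDetour-edges)
shortDetour-loses = firstCycle-losing arena {Y = Y} {p = p}
  (firstCycle-prefix arena p 3 (λ _ _ → refl) refl
    λ { 0 _ → refl ; 1 _ → refl ; 2 _ → refl ; (suc (suc (suc _))) (s≤s (s≤s (s≤s ()))) })
  λ { (inj₁ ()) ; (inj₂ ()) }
  where p = shortDetour , shortDetour-edges

-- A memoryless σ either returns directly from x (losing to the long branch)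
-- or detours (losing to the short branch).
no-memoryless-win : (S : Strategy arena Fin.zero) → Memoryless arena S → ¬ WinningFrom S vs
no-memoryless-win S@(σ , legal) mem win with legal [] vx refl
... | inj₁ σx≡s = longDirect-loses
  (win p refl (memoryless-consistent arena S mem p follows))
  where
  p = longDirect , longDirect-edges
  follows : ∀ j → owner⁺ (longDirect j) ≡ Fin.zero → longDirect (suc j) ≡ σ [] (longDirect j)
  follows 0 ()
  follows 1 _ = sym (legal [] vb refl)
  follows 2 _ = sym (legal [] vc refl)
  follows 3 _ = sym σx≡s
  follows (suc (suc (suc (suc n)))) owns = follows n owns
... | inj₂ σx≡t = shortDetour-loses
  (win p refl (memoryless-consistent arena S mem p follows))
  where
  p = shortDetour , shortDetour-edges
  follows : ∀ j → owner⁺ (shortDetour j) ≡ Fin.zero → shortDetour (suc j) ≡ σ [] (shortDetour j)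
  follows 0 ()
  follows 1 _ = sym (legal [] va refl)
  follows 2 _ = sym σx≡t
  follows 3 _ = sym (legal [] vt refl)
  follows (suc (suc (suc (suc n)))) owns = follows n owns

visitedLong : List Vertex → Bool
visitedLong = any (λ v → ⌊ v ≟ vb ⌋)

rememberBranch : List Vertex → Vertex → Vertex
rememberBranch history vx = if visitedLong history then vt else vs
rememberBranch history v  = proj₁ (successor v)

rememberBranch-legal : ∀ history v → owner⁺ v ≡ Fin.zero → Edge⁺ v (rememberBranch history v)
rememberBranch-legal history vs ()
rememberBranch-legal history va _ = refl
rememberBranch-legal history vb _ = refl
rememberBranch-legal history vc _ = refl
rememberBranch-legal history vx _ with visitedLong history
... | true  = inj₂ refl
... | false = inj₁ refl
rememberBranch-legal history vt _ = refl

remember : Strategy arena Fin.zero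
remember = rememberBranch , rememberBranch-legal

-- The first rounds of the two plays consistent with `remember` from s; what
-- follows them is irrelevant for the first cycle.
shortRound : ℕ → Vertex
shortRound 1 = va
shortRound 2 = vx
shortRound _ = vs

longRound : ℕ → Vertex
longRound 1 = vb
longRound 2 = vc
longRound 3 = vx
longRound 4 = vt
longRound _ = vs

remember-wins : WinningFrom remember vs
remember-wins p@(π , _) π0 consistent with edgeFrom arena p π0
... | inj₁ π1 = _ , firstCycle-prefix arena p 2 agree refl
                      (λ { 0 _ → refl ; 1 _ → refl ; (suc (suc _)) (s≤s (s≤s ())) })
                  , inj₁ refl
  where
  π2 = edgeFrom arena p π1
  π3 : π 3 ≡ vs
  π3 = trans (consistent 2 (cong owner⁺ π2))
             (cong₂ rememberBranch (cong₂ _∷_ π0 (cong (_∷ []) π1)) π2)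
  agree : AgreeUpTo arena π 3 shortRound
  agree 0 _ = π0
  agree 1 _ = π1
  agree 2 _ = π2
  agree 3 _ = π3
  agree (suc (suc (suc (suc _)))) (s≤s (s≤s (s≤s ())))
... | inj₂ π1 = _ , firstCycle-prefix arena p 4 agree refl
                      (λ { 0 _ → refl ; 1 _ → refl ; 2 _ → refl ; 3 _ → refl
                         ; (suc (suc (suc (suc _)))) (s≤s (s≤s (s≤s (s≤s ())))) })
                  , inj₂ refl
  where
  π2 = edgeFrom arena p π1
  π3 = edgeFrom arena p π2
  π4 : π 4 ≡ vt
  π4 = trans (consistent 3 (cong owner⁺ π3))
             (cong₂ rememberBranch (cong₂ _∷_ π0 (cong₂ _∷_ π1 (cong (_∷ []) π2))) π3)
  π5 = edgeFrom arena p π4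
  agree : AgreeUpTo arena π 5 longRound
  agree 0 _ = π0
  agree 1 _ = π1
  agree 2 _ = π2
  agree 3 _ = π3
  agree 4 _ = π4
  agree 5 _ = π5
  agree (suc (suc (suc (suc (suc (suc _)))))) (s≤s (s≤s (s≤s (s≤s (s≤s ())))))

proposition1 : Σ Set λ U → Σ (List U → Set) λ Y → Σ (Arena U) λ A →
    ClosedUnderCyclicPermutations Y
    × ¬ Game.PointwiseMemorylessDetermined A (O-FC A Y)
proposition1 = ⊤ , Y , arena , length-closed GoodLength , λ (_ , memoryless₀ , _) →
  let (S , memoryless , winning) = memoryless₀ vs (remember , remember-wins)
  in no-memoryless-win S memoryless winning
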